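{- Let $H$ be an atomic monoid. (1) If $H$ is half-factorial, then $\mathsf c_{\mathrm{adj}}(H)=0$ and $\mathsf c_{\mathrm{mon}}(H)=\mathsf c_{\mathrm{eq}}(H)=\mathsf c(H)$. (2) If $a\in H$ satisfies $|\mathsf L(a)|\le2$, then $\mu_{\mathrm{adj}}(a)\le\mathsf t(H)$.
   Context: A monoid is a commutative, cancellative semigroup with identity; $H^\times$ its unit group, $H_{\mathrm{red}}=H/H^\times$; $H$ is atomic if every non-unit is a product of atoms. $\mathsf Z(H)$ is the free abelian monoid on the set $\mathcal A(H_{\mathrm{red}})$ of atoms of $H_{\mathrm{red}}$, $\pi_H:\mathsf Z(H)\to H_{\mathrm{red}}$ the homomorphism that is the identity on atoms; $\mathsf Z(a)=\pi_H^{ -1}(aH^\times)$, $\mathsf L(a)=\{|z|:z\in\mathsf Z(a)\}$, $\mathsf Z_k(a)=\{z\in\mathsf Z(a):|z|=k\}$. $H$ is half-factorial if $|\mathsf L(a)|=1$ for all $a\in H\setminus H^\times$. $\mathsf d(z,z')=\max\{|z/\gcd(z,z')|,|z'/\gcd(z,z')|\}$, $\mathsf d(X,Y)=\min\{\mathsf d(x,y):x\in X,y\in Y\}$. Lengths $k<l$ in $\mathsf L(a)$ are adjacent if $[k,l]\cap\mathsf L(a)=\{k,l\}$. The supremum of the empty set is $0$. For $N\in\mathbb N$, an $N$-chain concatenating $z_0,z_n\in\mathsf Z(a)$ is a sequence $z_0,\dots,z_n\in\mathsf Z(a)$ with $\mathsf d(z_{i-1},z_i)\le N$ for all $i$; monotone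 if $|z_{i-1}|\le|z_i|$, equal-length if $|z_{i-1}|=|z_i|$ for all $i$. $\mathsf c(a)$, $\mathsf c_{\mathrm{mon}}(a)$, $\mathsf c_{\mathrm{eq}}(a)$ are the smallest $N\in\mathbb N_0\cup\{\infty\}$ such that any two factorizations of $a$ can be concatenated by an $N$-chain, a monotone $N$-chain, an equal-length $N$-chain respectively; $\mathsf c(H),\mathsf c_{\mathrm{mon}}(H),\mathsf c_{\mathrm{eq}}(H)$ are the suprema over $a\in H$. $\mathsf c_{\mathrm{adj}}(a)=\sup\{\mathsf d(\mathsf Z_k(a),\mathsf Z_l(a)):k,l\in\mathsf L(a)\text{ adjacent}\}$, $\mathsf c_{\mathrm{adj}}(H)=\sup_a\mathsf c_{\mathrm{adj}}(a)$. $\mu_{\mathrm{adj}}(a)=\sup\{k\in\mathsf L(a):\text{there is }l\in\mathsf L(a),\ l<k,\ l\text{ adjacent to }k,\text{ with }\mathsf d(\mathsf Z_k(a),\mathsf Z_l(a))=k\}$. Tame degree: for $a\in H$ and $x\in\mathsf Z(H)$, $\mathsf t(a,x)$ is the smallest $N\in\mathbb N_0\cup\{\infty\}$ such that, if $\mathsf Z(a)\cap x\mathsf Z(H)\ne\emptyset$ and $z\in\mathsf Z(a)$, then there is $z'\in\mathsf Z(a)\cap x\mathsf Z(H)$ with $\mathsf d(z,z')\le N$; $\mathsf t(H)=\sup\{\mathsf t(a,u):a\in H,\ u\in\mathcal A(H_{\mathrm{red}})\}$. -}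

module Defs where

open import Level using (Level)
open import Algebra.Bundles using (CommutativeMonoid)
open import Data.Nat using (ℕ; _≤_; _<_; _∸_; _⊔_)
open import Data.List using (List; []; _∷_; _++_; length; foldr; map)
open import Data.Product using (Σ; ∃; ∃-syntax; _×_; _,_; proj₁)
open import Data.Sum using (_⊎_)
open import Relation.Nullary using (¬_)
open import Relation.Binary.PropositionalEquality using (_≡_)
open import Relation.Binary.Construct.Closure.ReflexiveTransitive using (Star)
open import Data.List.Relation.Binary.Permutation.Homogeneous using (Permutation)

module _ {c ℓ : Level} (M : CommutativeMonoid c ℓ) where
  open CommutativeMonoid M renaming (Carrier to H)

  IsCancellative : Set (c Level.⊔ ℓ)
  IsCancellative = ∀ a b d → (a ∙ b) ≈ (a ∙ d) → b ≈ d

  IsUnit : H → Set (c Level.⊔ ℓ)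
  IsUnit u = ∃[ v ] ((u ∙ v) ≈ ε)

  Assoc : H → H → Set (c Level.⊔ ℓ)
  Assoc a b = ∃[ u ] (IsUnit u × a ≈ (b ∙ u))

  IsAtom : H → Set (c Level.⊔ ℓ)
  IsAtom a = ¬ IsUnit a × (∀ b d → a ≈ (b ∙ d) → IsUnit b ⊎ IsUnit d)

  Atom : Set (c Level.⊔ ℓ)
  Atom = Σ H IsAtom

  -- Z(H): the free abelian monoid on A(H_red), represented by finite lists of
  -- atoms of H; two lists denote the same element of Z(H) iff they are
  -- permutations of each other up to associated atoms (_≋_ below).
  Fact : Set (c Level.⊔ ℓ)
  Fact = List Atom

  _≋_ : Fact → Fact → Set (c Level.⊔ ℓ)
  _≋_ = Permutation (λ (x y : Atom) → Assoc (proj₁ x) (proj₁ y))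

  -- π_H (composed with the choice of representatives)
  π : Fact → H
  π z = foldr _∙_ ε (map proj₁ z)

  IsAtomic : Set (c Level.⊔ ℓ)
  IsAtomic = ∀ a → ¬ IsUnit a → ∃[ z ] (a ≈ π z)

  InZ : H → Fact → Set (c Level.⊔ ℓ)
  InZ a z = Assoc (π z) a

  InZk : H → ℕ → Fact → Set (c Level.⊔ ℓ)
  InZk a k z = InZ a z × length z ≡ k

  InL : H → ℕ → Set (c Level.⊔ ℓ)
  InL a k = ∃[ z ] (InZ a z × length z ≡ k)

  IsHalfFactorial : Set (c Level.⊔ ℓ)
  IsHalfFactorial = ∀ a → ¬ IsUnit a →
    (∃[ k ] InL a k) × (∀ k l → InL a k → InL a l → k ≡ l)

  LengthSetAtMostTwo : H → Set (c Level.⊔ ℓ)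
  LengthSetAtMostTwo a = ∀ k l m → InL a k → InL a l → InL a m →
    k ≡ l ⊎ k ≡ m ⊎ l ≡ m

  _∣Z_ : Fact → Fact → Set (c Level.⊔ ℓ)
  w ∣Z z = ∃[ r ] ((w ++ r) ≋ z)

  IsGcd : Fact → Fact → Fact → Set (c Level.⊔ ℓ)
  IsGcd w z z' = w ∣Z z × w ∣Z z' × (∀ v → v ∣Z z → v ∣Z z' → v ∣Z w)

  Dist : Fact → Fact → ℕ → Set (c Level.⊔ ℓ)
  Dist z z' n = ∃[ w ] (IsGcd w z z' × n ≡ ((length z ∸ length w) ⊔ (length z' ∸ length w)))

  DistLe : Fact → Fact → ℕ → Set (c Level.⊔ ℓ)
  DistLe z z' N = ∃[ n ] (Dist z z' n × n ≤ N)

  -- d(X,Y) ≤ N   (minimum of a set of naturals is ≤ N iff some element is)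
  SetDistLe : (Fact → Set (c Level.⊔ ℓ)) → (Fact → Set (c Level.⊔ ℓ)) → ℕ → Set (c Level.⊔ ℓ)
  SetDistLe X Y N = ∃[ x ] ∃[ y ] (X x × Y y × DistLe x y N)

  SetDistEq : (Fact → Set (c Level.⊔ ℓ)) → (Fact → Set (c Level.⊔ ℓ)) → ℕ → Set (c Level.⊔ ℓ)
  SetDistEq X Y n = (∃[ x ] ∃[ y ] (X x × Y y × Dist x y n))
                  × (∀ x y m → X x → Y y → Dist x y m → n ≤ m)

  Step : H → ℕ → Fact → Fact → Set (c Level.⊔ ℓ)
  Step a N z z' = InZ a z' × DistLe z z' N

  StepMon : H → ℕ → Fact → Fact → Set (c Level.⊔ ℓ)
  StepMon a N z z' = Step a N z z' × length z ≤ length z'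

  StepEq : H → ℕ → Fact → Fact → Set (c Level.⊔ ℓ)
  StepEq a N z z' = Step a N z z' × length z ≡ length z'

  CatLe : ℕ → Set (c Level.⊔ ℓ)
  CatLe N = ∀ a z z' → InZ a z → InZ a z' → Star (Step a N) z z'

  CatMonLe : ℕ → Set (c Level.⊔ ℓ)
  CatMonLe N = ∀ a z z' → InZ a z → InZ a z' → Star (StepMon a N) z z'

  CatEqLe : ℕ → Set (c Level.⊔ ℓ)
  CatEqLe N = ∀ a z z' → InZ a z → InZ a z' → Star (StepEq a N) z z'

  Adjacent : H → ℕ → ℕ → Set (c Level.⊔ ℓ)
  Adjacent a k l = k < l × InL a k × InL a l
                 × (∀ m → InL a m → k ≤ m → m ≤ l → m ≡ k ⊎ m ≡ l)

  CatAdjLe : ℕ → Set (c Level.⊔ ℓ)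
  CatAdjLe N = ∀ a k l → Adjacent a k l → SetDistLe (InZk a k) (InZk a l) N

  MuAdjLe : H → ℕ → Set (c Level.⊔ ℓ)
  MuAdjLe a N = ∀ k l → Adjacent a l k → SetDistEq (InZk a k) (InZk a l) k → k ≤ N

  TameAtLe : H → Fact → ℕ → Set (c Level.⊔ ℓ)
  TameAtLe a x N = (∃[ z ] (InZ a z × x ∣Z z)) →
    ∀ z → InZ a z → ∃[ z' ] (InZ a z' × x ∣Z z' × DistLe z z' N)

  TameLe : ℕ → Set (c Level.⊔ ℓ)
  TameLe N = ∀ a (u : Atom) → TameAtLe a (u ∷ []) N

{-# OPTIONS --safe #-}
-- In a half-factorial monoid all factorizations of an element have the same length,
-- so there are no adjacent lengths at all and every chain is automatically monotone
-- and equal-length.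
--
-- For (2), let l < k be adjacent lengths of a with d(Z_k(a), Z_l(a)) = k, and pick
-- x ∈ Z_k(a), y ∈ Z_l(a) and an atom u dividing x. Tameness gives z ∈ Z(a) divisible
-- by u with d(y, z) ≤ t(H). As |L(a)| ≤ 2, either |z| = k, and then
-- k = d(Z_k(a), Z_l(a)) ≤ d(z, y) ≤ t(H); or |z| = l, and then u divides gcd(x, z),
-- so d(x, z) ≤ max(k - 1, l) < k, contradicting minimality.
module Submission where

open import Defs
open import Level using (Level)
open import Algebra.Bundles using (CommutativeMonoid)
open import Data.Nat using (suc; _≤_; _<_; _∸_; s≤s; z≤n; _≤?_)
open import Data.Nat.Properties
  using (m∸n≤m; ⊔-lub; ⊔-comm; ≤-trans; ≤-reflexive; <-irrefl; <⇒≱; ≤-<-trans)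
open import Data.List using ([]; _∷_; _++_; [_]; length)
open import Data.List.Relation.Unary.Any using (here)
import Data.List.Relation.Unary.Any.Properties as Any
open import Data.Product using (∃-syntax; _×_; _,_; proj₁; proj₂)
open import Data.Sum using (_⊎_; inj₁; inj₂)
open import Data.Empty using (⊥; ⊥-elim)
open import Relation.Nullary using (¬_)
open import Relation.Nullary.Decidable using (decidable-stable)
open import Relation.Binary.PropositionalEquality as ≡ using (_≡_; refl)
open import Relation.Binary.Bundles using (Setoid)
open import Relation.Binary.Construct.Closure.ReflexiveTransitive as Star
  using (Star; ε; _◅_)
import Relation.Binary.Reasoning.Setoid as SetoidReasoning
import Data.List.Relation.Binary.Permutation.Setoid as Permutation
import Data.List.Relation.Binary.Permutation.Setoid.Properties as PermutationProperties
import Data.List.Membership.Setoid as Membership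
import Data.List.Membership.Setoid.Properties as MembershipProperties
import Algebra.Properties.CommutativeSemigroup as CommutativeSemigroupProperties

m∸n<m : ∀ {m n} → 0 < m → 0 < n → m ∸ n < m
m∸n<m {suc m} {suc n} _ _ = s≤s (m∸n≤m m n)

¬¬-excluded-middle : ∀ {p} (P : Set p) → ¬ ¬ (P ⊎ ¬ P)
¬¬-excluded-middle P k = k (inj₂ (λ p → k (inj₁ p)))

module _ {c ℓ : Level} (M : CommutativeMonoid c ℓ) where
  open CommutativeMonoid M renaming (Carrier to H; ε to 1#; refl to ≈-refl)
  open CommutativeSemigroupProperties commutativeSemigroup using (interchange)
  open SetoidReasoning setoid

  Assoc-refl : ∀ a → Assoc M a a
  Assoc-refl a = 1# , (1# , identityˡ 1#) , sym (identityʳ a)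

  Assoc-sym : ∀ a b → Assoc M a b → Assoc M b a
  Assoc-sym a b (u , (v , uv≈1) , a≈bu) = v , (u , trans (comm v u) uv≈1) , (begin
    b             ≈⟨ sym (identityʳ b) ⟩
    b ∙ 1#        ≈⟨ ∙-congˡ (sym uv≈1) ⟩
    b ∙ (u ∙ v)   ≈⟨ sym (assoc b u v) ⟩
    (b ∙ u) ∙ v   ≈⟨ ∙-congʳ (sym a≈bu) ⟩
    a ∙ v         ∎)

  Assoc-trans : ∀ a b d → Assoc M a b → Assoc M b d → Assoc M a d
  Assoc-trans a b d (u , (v , uv≈1) , a≈bu) (u' , (v' , u'v'≈1) , b≈du') =
    u' ∙ u ,
    (v' ∙ v , trans (interchange u' u v' v) (trans (∙-cong u'v'≈1 uv≈1) (identityˡ 1#))) ,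
    (begin
      a              ≈⟨ a≈bu ⟩
      b ∙ u          ≈⟨ ∙-congʳ b≈du' ⟩
      (d ∙ u') ∙ u   ≈⟨ assoc d u' u ⟩
      d ∙ (u' ∙ u)   ∎)

  atomSetoid : Setoid (c Level.⊔ ℓ) (c Level.⊔ ℓ)
  atomSetoid = record
    { Carrier       = Atom M
    ; _≈_           = λ x y → Assoc M (proj₁ x) (proj₁ y)
    ; isEquivalence = record
      { refl  = λ {x} → Assoc-refl (proj₁ x)
      ; sym   = λ {x} {y} → Assoc-sym (proj₁ x) (proj₁ y)
      ; trans = λ {x} {y} {z} → Assoc-trans (proj₁ x) (proj₁ y) (proj₁ z)
      }
    }

  open Permutation atomSetoid using (_↭_; ↭-refl; ↭-sym; ↭-trans; prep; ↭-reflexive-≋)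
  open PermutationProperties atomSetoid
    using (∈-resp-↭; xs↭ys⇒|xs|≡|ys|; shift; ↭-shift; ++⁺ʳ; ++⁺ˡ; drop-∷)
  open Membership atomSetoid using (_∈_)

  private
    _∣_ : Fact M → Fact M → Set (c Level.⊔ ℓ)
    _∣_ = _∣Z_ M

    ∈-∷ : ∀ (u : Atom M) xs → u ∈ (u ∷ xs)
    ∈-∷ u xs = here (Assoc-refl (proj₁ u))

    ∷-cong : ∀ (u : Atom M) {xs ys} → xs ↭ ys → (u ∷ xs) ↭ (u ∷ ys)
    ∷-cong u = prep (Assoc-refl (proj₁ u))

  ∈⇒↭∷ : ∀ {u : Atom M} {xs} → u ∈ xs → ∃[ xs' ] (xs ↭ (u ∷ xs'))
  ∈⇒↭∷ {u} u∈xs with MembershipProperties.∈-∃++ atomSetoid {u} u∈xs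
  ... | ys , zs , v , u≈v , xs≋ = ys ++ zs ,
    ↭-trans (↭-reflexive-≋ xs≋) (shift (Assoc-sym (proj₁ u) (proj₁ v) u≈v) ys zs)

  ++-cancel-∈ʳ : ∀ v r z (u : Atom M) → u ∈ r → (v ++ r) ↭ (u ∷ z) → ∃[ r' ] ((v ++ r') ↭ z)
  ++-cancel-∈ʳ v r z u u∈r vr↭uz with ∈⇒↭∷ u∈r
  ... | r' , r↭ur' =
    r' , drop-∷ (↭-trans (↭-sym (↭-shift v r')) (↭-trans (↭-sym (++⁺ˡ v r↭ur')) vr↭uz))

  ++-cancel-∈ˡ : ∀ v r z (u : Atom M) → u ∈ v → (v ++ r) ↭ (u ∷ z) →
                 ∃[ v' ] ((v ↭ (u ∷ v')) × ((v' ++ r) ↭ z))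
  ++-cancel-∈ˡ v r z u u∈v vr↭uz with ∈⇒↭∷ u∈v
  ... | v' , v↭uv' = v' , v↭uv' , drop-∷ (↭-trans (↭-sym (++⁺ʳ r v↭uv')) vr↭uz)

  IsGcd-[] : ∀ y → IsGcd M [] [] y
  IsGcd-[] y = ([] , ↭-refl) , (y , ↭-refl) , λ _ v∣[] _ → v∣[]

  IsGcd-∷-shared : ∀ u x y y' w → IsGcd M w x y' → y ↭ (u ∷ y') → IsGcd M (u ∷ w) (u ∷ x) y
  IsGcd-∷-shared u x y y' w ((r , wr↭x) , (s , ws↭y') , greatest) y↭uy' =
    (r , ∷-cong u wr↭x) , (s , ↭-trans (∷-cong u ws↭y') (↭-sym y↭uy')) , greatest'
    where
    u∈v⇒∣ : ∀ v r s → u ∈ v → (v ++ r) ↭ (u ∷ x) → (v ++ s) ↭ y → v ∣ (u ∷ w)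
    u∈v⇒∣ v r s u∈v vr↭ux vs↭y
      with ++-cancel-∈ˡ v r x u u∈v vr↭ux | ++-cancel-∈ˡ v s y' u u∈v (↭-trans vs↭y y↭uy')
    ... | v' , v↭uv' , v'r↭x | v'' , v↭uv'' , v''s↭y'
      with greatest v' (r , v'r↭x)
             (s , ↭-trans (++⁺ʳ s (drop-∷ (↭-trans (↭-sym v↭uv') v↭uv''))) v''s↭y')
    ... | t , v't↭w = t , ↭-trans (++⁺ʳ t v↭uv') (∷-cong u v't↭w)

    greatest' : ∀ v → v ∣ (u ∷ x) → v ∣ y → v ∣ (u ∷ w)
    greatest' v (r , vr↭ux) (s , vs↭y)
      with Any.++⁻ v (∈-resp-↭ {u} (↭-sym vr↭ux) (∈-∷ u x))
         | Any.++⁻ v (∈-resp-↭ {u} (↭-sym (↭-trans vs↭y y↭uy')) (∈-∷ u y'))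
    ... | inj₁ u∈v | _        = u∈v⇒∣ v r s u∈v vr↭ux vs↭y
    ... | inj₂ _   | inj₁ u∈v = u∈v⇒∣ v r s u∈v vr↭ux vs↭y
    ... | inj₂ u∈r | inj₂ u∈s
      with ++-cancel-∈ʳ v r x u u∈r vr↭ux | ++-cancel-∈ʳ v s y' u u∈s (↭-trans vs↭y y↭uy')
    ... | r' , vr'↭x | s' , vs'↭y' with greatest v (r' , vr'↭x) (s' , vs'↭y')
    ... | t , vt↭w = u ∷ t , ↭-trans (↭-shift v t) (∷-cong u vt↭w)

  IsGcd-∷-unshared : ∀ u x y w → IsGcd M w x y → ¬ (u ∈ y) → IsGcd M w (u ∷ x) y
  IsGcd-∷-unshared u x y w ((r , wr↭x) , w∣y , greatest) u∉y =
    (u ∷ r , ↭-trans (↭-shift w r) (∷-cong u wr↭x)) , w∣y , greatest'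
    where
    greatest' : ∀ v → v ∣ (u ∷ x) → v ∣ y → v ∣ w
    greatest' v (r , vr↭ux) (s , vs↭y) with Any.++⁻ v (∈-resp-↭ {u} (↭-sym vr↭ux) (∈-∷ u x))
    ... | inj₁ u∈v = ⊥-elim (u∉y (∈-resp-↭ {u} vs↭y (Any.++⁺ˡ u∈v)))
    ... | inj₂ u∈r with ++-cancel-∈ʳ v r x u u∈r vr↭ux
    ... | r' , vr'↭x = greatest v (r' , vr'↭x) (s , vs↭y)

  -- Membership up to associates is undecidable, so gcds exist only up to double negation.
  ¬¬-gcd : ∀ x y → ¬ ¬ (∃[ w ] IsGcd M w x y)
  ¬¬-gcd []      y k = k ([] , IsGcd-[] y)
  ¬¬-gcd (u ∷ x) y k = ¬¬-excluded-middle (u ∈ y) λ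
    { (inj₁ u∈y) → let (y' , y↭uy') = ∈⇒↭∷ u∈y in
        ¬¬-gcd x y' λ { (w , gcd) → k (u ∷ w , IsGcd-∷-shared u x y y' w gcd y↭uy') }
    ; (inj₂ u∉y) → ¬¬-gcd x y λ { (w , gcd) → k (w , IsGcd-∷-unshared u x y w gcd u∉y) } }

  IsGcd-common-atom⇒0<length : ∀ {w x y} (u : Atom M) → IsGcd M w x y →
                                [ u ] ∣ x → [ u ] ∣ y → 0 < length w
  IsGcd-common-atom⇒0<length u (_ , _ , greatest) u∣x u∣y with greatest [ u ] u∣x u∣y
  ... | t , ut↭w = ≡.subst (0 <_) (xs↭ys⇒|xs|≡|ys| ut↭w) (s≤s z≤n)

  ¬¬-common-atom⇒Dist< : ∀ x y (u : Atom M) → [ u ] ∣ x → [ u ] ∣ y → length y < length x →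
                         ¬ ¬ (∃[ n ] (Dist M x y n × n < length x))
  ¬¬-common-atom⇒Dist< x y u u∣x u∣y |y|<|x| k = ¬¬-gcd x y λ { (w , gcd) →
    let 0<|w| = IsGcd-common-atom⇒0<length u gcd u∣x u∣y in
    k (_ , (w , gcd , refl) ,
       ⊔-lub (m∸n<m (≤-<-trans z≤n |y|<|x|) 0<|w|)
             (≤-<-trans (m∸n≤m (length y) (length w)) |y|<|x|)) }

  Dist-sym : ∀ x y n → Dist M x y n → Dist M y x n
  Dist-sym x y n (w , (w∣x , w∣y , greatest) , n≡) =
    w , (w∣y , w∣x , λ v v∣y v∣x → greatest v v∣x v∣y) ,
    ≡.trans n≡ (⊔-comm (length x ∸ length w) (length y ∸ length w))

  InZ-∷⇒¬IsUnit : ∀ a (u : Atom M) z → InZ M a (u ∷ z) → ¬ IsUnit M a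
  InZ-∷⇒¬IsUnit a (u , ¬unit , _) z (e , (e' , ee'≈1) , uz≈ae) (v , av≈1) =
    ¬unit (π M z ∙ (v ∙ e') , (begin
      u ∙ (π M z ∙ (v ∙ e'))   ≈⟨ sym (assoc _ _ _) ⟩
      (u ∙ π M z) ∙ (v ∙ e')   ≈⟨ ∙-congʳ uz≈ae ⟩
      (a ∙ e) ∙ (v ∙ e')       ≈⟨ interchange a e v e' ⟩
      (a ∙ v) ∙ (e ∙ e')       ≈⟨ ∙-cong av≈1 ee'≈1 ⟩
      1# ∙ 1#                  ≈⟨ identityˡ 1# ⟩
      1#                       ∎))

  module HalfFactorial (hf : IsHalfFactorial M) where

    InZ⇒length-unique : ∀ a z z' → InZ M a z → InZ M a z' → length z ≡ length z'
    InZ⇒length-unique a []      []       _  _  = refl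
    InZ⇒length-unique a (u ∷ z) z'       az az' =
      proj₂ (hf a (InZ-∷⇒¬IsUnit a u z az)) _ _ (u ∷ z , az , refl) (z' , az' , refl)
    InZ⇒length-unique a []      (u ∷ z') az az' =
      proj₂ (hf a (InZ-∷⇒¬IsUnit a u z' az')) _ _ ([] , az , refl) (u ∷ z' , az' , refl)

    ¬Adjacent : ∀ a k l → ¬ Adjacent M a k l
    ¬Adjacent a k l (k<l , (z , az , |z|≡k) , (z' , az' , |z'|≡l) , _) =
      <-irrefl (≡.trans (≡.sym |z|≡k) (≡.trans (InZ⇒length-unique a z z' az az') |z'|≡l)) k<l

    chain⇒eq-chain : ∀ {a N z z'} → InZ M a z → Star (Step M a N) z z' → Star (StepEq M a N) z z'
    chain⇒eq-chain az ε = ε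
    chain⇒eq-chain {a} {z = z} az (_◅_ {j = z₁} step steps) =
      (step , InZ⇒length-unique a z z₁ az (proj₁ step)) ◅ chain⇒eq-chain (proj₁ step) steps

  CatMonLe⇒CatLe : ∀ N → CatMonLe M N → CatLe M N
  CatMonLe⇒CatLe N cat a z z' az az' = Star.map proj₁ (cat a z z' az az')

  CatEqLe⇒CatLe : ∀ N → CatEqLe M N → CatLe M N
  CatEqLe⇒CatLe N cat a z z' az az' = Star.map proj₁ (cat a z z' az az')

  CatEqLe⇒CatMonLe : ∀ N → CatEqLe M N → CatMonLe M N
  CatEqLe⇒CatMonLe N cat a z z' az az' =
    Star.map (λ (step , |z|≡|z'|) → step , ≤-reflexive |z|≡|z'|) (cat a z z' az az')

  halfFactorial⇒CatEqLe : IsHalfFactorial M → ∀ N → CatLe M N → CatEqLe M N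
  halfFactorial⇒CatEqLe hf N cat a z z' az az' =
    HalfFactorial.chain⇒eq-chain hf az (cat a z z' az az')

  halfFactorial⇒CatAdjLe0 : IsHalfFactorial M → CatAdjLe M 0
  halfFactorial⇒CatAdjLe0 hf a k l adj = ⊥-elim (HalfFactorial.¬Adjacent hf a k l adj)

  MuAdjLe-tame : ∀ a → LengthSetAtMostTwo M a → ∀ N → TameLe M N → MuAdjLe M a N
  MuAdjLe-tame a L≤2 N tame k l (l<k , (y , ay , |y|≡l) , (x , ax , |x|≡k) , _) (_ , minimal)
    with x
  ... | [] = ⊥-elim (<⇒≱ l<k (≡.subst (_≤ l) |x|≡k z≤n))
  ... | u ∷ x' with tame a u (u ∷ x' , ax , (x' , ↭-refl)) y ay
  ... | z , az , u∣z , (n , dist , n≤N)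
    with L≤2 k l (length z) (u ∷ x' , ax , |x|≡k) (y , ay , |y|≡l) (z , az , refl)
  ... | inj₁ k≡l = ⊥-elim (<-irrefl (≡.sym k≡l) l<k)
  ... | inj₂ (inj₁ k≡|z|) =
    ≤-trans (minimal z y n (az , ≡.sym k≡|z|) (ay , |y|≡l) (Dist-sym y z n dist)) n≤N
  ... | inj₂ (inj₂ l≡|z|) = decidable-stable (k ≤? N) λ _ →
    ¬¬-common-atom⇒Dist< (u ∷ x') z u (x' , ↭-refl) u∣z
      (≡.subst₂ _<_ l≡|z| (≡.sym |x|≡k) l<k)
      λ { (m , dist' , m<|x|) →
          <⇒≱ (≡.subst (m <_) |x|≡k m<|x|) (minimal (u ∷ x') z m (ax , |x|≡k) (az , ≡.sym l≡|z|) dist') }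

lemma4p4 : ∀ {c ℓ : Level} (M : CommutativeMonoid c ℓ)
    → IsCancellative M → IsAtomic M
    → (IsHalfFactorial M
        → CatAdjLe M 0
          × (∀ N → (CatMonLe M N → CatLe M N) × (CatLe M N → CatMonLe M N))
          × (∀ N → (CatEqLe M N → CatLe M N) × (CatLe M N → CatEqLe M N)))
      × (∀ a → LengthSetAtMostTwo M a → ∀ N → TameLe M N → MuAdjLe M a N)
lemma4p4 M _ _ =
  (λ hf → halfFactorial⇒CatAdjLe0 M hf
        , (λ N → CatMonLe⇒CatLe M N
               , λ cat → CatEqLe⇒CatMonLe M N (halfFactorial⇒CatEqLe M hf N cat))
        , (λ N → CatEqLe⇒CatLe M N , halfFactorial⇒CatEqLe M hf N))
  , MuAdjLe-tame M
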